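{- Let $k\ge 2$ and $n$ be positive integers. Under the $\{12\cdots k,\ k\cdots 21\}$-equivalence, every permutation in $S_n$ is equivalent to a permutation $b_1\cdots b_n\in S_n$ with $b_i = i$ for all $1\le i\le n-(3k^2-6k+5)$.
   Context: $S_n$ is the set of permutations of $\{1,\dots,n\}$ written as words. A pattern-replacement under the $\{12\cdots k, k\cdots 21\}$-equivalence takes $k$ letters of a permutation, at arbitrary (not necessarily adjacent) positions, that are in increasing (resp. decreasing) order and rearranges them within those positions into decreasing (resp. increasing) order; two permutations are equivalent if one is reachable from the other by finitely many such replacements. -}

module Defs where

open import Data.Nat using (ℕ)
open import Data.Fin using (Fin; _<_; opposite)
open import Data.Product using (Σ; _×_)
open import Data.Sum using (_⊎_)
open import Relation.Binary.PropositionalEquality using (_≡_; _≢_)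
open import Relation.Binary.Construct.Closure.ReflexiveTransitive using (Star)

-- A word of length n over the alphabet Fin n (letters 0..n-1 stand for 1..n).
Word : ℕ → Set
Word n = Fin n → Fin n

StrictlyIncreasingPositions : ∀ {k n} → (Fin k → Fin n) → Set
StrictlyIncreasingPositions p = ∀ i j → i < j → p i < p j

IncreasingAt : ∀ {k n} → Word n → (Fin k → Fin n) → Set
IncreasingAt w p = ∀ i j → i < j → w (p i) < w (p j)

DecreasingAt : ∀ {k n} → Word n → (Fin k → Fin n) → Set
DecreasingAt w p = ∀ i j → i < j → w (p j) < w (p i)

-- One {12…k, k…21}-replacement: pick k positions whose letters form an
-- increasing (resp. decreasing) subsequence and rearrange these letters
-- within those positions into decreasing (resp. increasing) order, i.e.
-- reverse them; all other letters stay put.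
Replace : ℕ → ∀ {n} → Word n → Word n → Set
Replace k {n} w w′ =
  Σ (Fin k → Fin n) λ p →
    StrictlyIncreasingPositions p
    × (IncreasingAt w p ⊎ DecreasingAt w p)
    × (∀ i → w′ (p i) ≡ w (p (opposite i)))
    × (∀ j → (∀ i → p i ≢ j) → w′ j ≡ w j)

Equiv : ℕ → ∀ {n} → Word n → Word n → Set
Equiv k = Star (Replace k)

-- A replacement reverses a monotone subsequence of length k = K + 1, and by
-- Erdős–Szekeres any K² + 1 positions carry one, which one more replacement
-- turns increasing or decreasing as needed. Suppose the positions below s are
-- fixed, so that the letter s is the least letter at positions ≥ s. First move s
-- into the last K² + 1 positions, reversing an increasing subsequence starting
-- at its position. Then look at the 2K² + 1 positions following s: if K² + 1 of
-- them hold letters larger than the one at position s, reversing an increasing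
-- subsequence starting at s raises that letter, which can happen only finitely
-- often; otherwise K² + 1 of them hold smaller letters, and a decreasing
-- subsequence from position s through K − 1 of those to the position of s puts s
-- in place. A stage uses 3K² + 3 positions, which leaves the last
-- 3K² + 2 = 3k² − 6k + 5 positions unsettled.

module Submission where

open import Defs
open import Data.Bool using (true; false)
open import Data.Fin as Fin using (Fin; zero; suc; toℕ; fromℕ; fromℕ<; inject≤; opposite; combine; _<?_)
open import Data.Fin.Induction using (>-wellFounded)
import Data.Fin.Properties as Fin
open import Data.List using (List; []; _∷_; length; lookup; map; filter; allFin; tabulate)
open import Data.List.Extrema.Nat using (argmax; argmax-all; f[xs]≤f[argmax])
open import Data.List.Membership.Propositional using (_∈_; _∉_)
open import Data.List.Membership.Propositional.Properties using (∈-map⁺; ∈-filter⁺; ∈-allFin; ∈-lookup)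
open import Data.List.Properties using (length-tabulate)
open import Data.List.Relation.Binary.Subset.Propositional using (_⊆_)
open import Data.List.Relation.Unary.All as All using (All; []; _∷_)
import Data.List.Relation.Unary.All.Properties as All
open import Data.List.Relation.Unary.AllPairs as AllPairs using (AllPairs; []; _∷_)
import Data.List.Relation.Unary.AllPairs.Properties as AllPairs
open import Data.List.Relation.Unary.Any using (here; there)
open import Data.Nat using (ℕ; zero; suc; _+_; _*_; _∸_; _≤_; _<_; _≤?_; z≤n; s≤s; s<s)
import Data.Nat.Properties as ℕ
open import Data.Nat.Tactic.RingSolver using (solve-∀)
open import Data.Product using (Σ; _×_; _,_; proj₁; proj₂; map₂; Σ-syntax; ∃-syntax)
open import Data.Sum as Sum using (_⊎_; inj₁; inj₂; [_,_]′)
open import Data.Vec.Functional as V using (Vector; head; tail)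
open import Function using (_∘_)
open import Function.Definitions using (Injective)
open import Induction.WellFounded using (Acc; acc)
open import Level using (Level; _⊔_)
open import Relation.Binary.Construct.Closure.ReflexiveTransitive using (ε; _◅_; _◅◅_)
open import Relation.Binary.Core using (Rel)
open import Relation.Binary.Definitions using (Decidable; Transitive; tri<; tri≈; tri>)
open import Relation.Binary.PropositionalEquality using (_≡_; _≢_; refl; sym; trans; cong; subst; subst₂; module ≡-Reasoning)
open import Relation.Nullary using (¬_; yes; no; does; contradiction)
open import Relation.Nullary.Decidable using (_⊎-dec_; _×-dec_)
import Relation.Unary as U
open import Relation.Unary.Properties using (∁?)

private variable
  a ℓ ℓ₁ ℓ₂ : Level
  A : Set a
  k m n : ℕ

All⇒∉ : {P : A → Set ℓ} {xs : List A} {y : A} → All P xs → ¬ P y → y ∉ xs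
All⇒∉ P-xs ¬Py y∈xs = ¬Py (All.lookup P-xs y∈xs)

length-filter-∁ : {P : U.Pred A ℓ} (P? : U.Decidable P) (xs : List A) →
                  length (filter P? xs) + length (filter (∁? P?) xs) ≡ length xs
length-filter-∁ P? []       = refl
length-filter-∁ P? (x ∷ xs) with does (P? x)
... | true  = cong suc (length-filter-∁ P? xs)
... | false = trans (ℕ.+-suc _ _) (cong suc (length-filter-∁ P? xs))

injective⇒surjective : {f : Fin n → Fin n} → Injective _≡_ _≡_ f → ∀ y → ∃[ i ] f i ≡ y
injective⇒surjective {suc n} {f} f-injective y with Fin.any? (λ i → f i Fin.≟ y)
... | yes hit  = hit
... | no miss = contradiction (Fin.injective⇒≤ {f = λ i → Fin.punchOut (avoids i)} punchOut-injective) ℕ.1+n≰n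
  where
  avoids : ∀ i → y ≢ f i
  avoids i y≡fᵢ = miss (i , sym y≡fᵢ)
  punchOut-injective : ∀ {i j} → Fin.punchOut (avoids i) ≡ Fin.punchOut (avoids j) → i ≡ j
  punchOut-injective eq = f-injective (Fin.punchOut-injective (avoids _) (avoids _) eq)

opposite-< : {i j : Fin n} → i Fin.< j → opposite j Fin.< opposite i
opposite-< {i = i} {j} i<j rewrite Fin.opposite-prop i | Fin.opposite-prop j =
  ℕ.∸-monoʳ-< (s<s i<j) (Fin.toℕ<n j)

segment : ∀ a len → a + len ≤ n → List (Fin n)
segment a len fits = tabulate λ (i : Fin len) → fromℕ< (ℕ.≤-trans (ℕ.+-monoʳ-< a (Fin.toℕ<n i)) fits)

module _ (a len : ℕ) (fits : a + len ≤ n) where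

  segment-length : length (segment a len fits) ≡ len
  segment-length = length-tabulate _

  segment-sorted : AllPairs Fin._<_ (segment a len fits)
  segment-sorted = AllPairs.tabulate⁺-< λ i<j →
    subst₂ _<_ (sym (Fin.toℕ-fromℕ< _)) (sym (Fin.toℕ-fromℕ< _)) (ℕ.+-monoʳ-< a i<j)

  segment-bounds : All (λ j → a ≤ toℕ j × toℕ j < a + len) (segment a len fits)
  segment-bounds = All.tabulate⁺ λ i →
    subst (λ v → a ≤ v × v < a + len) (sym (Fin.toℕ-fromℕ< _)) (ℕ.m≤m+n a _ , ℕ.+-monoʳ-< a (Fin.toℕ<n i))

Chain : Rel A ℓ → Vector A n → Set ℓ
Chain R v = ∀ i j → i Fin.< j → R (v i) (v j)

Chain-∘ : {R : Rel A ℓ} {v : Vector A n} {f : Fin m → Fin n} →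
          Chain R v → Chain Fin._<_ f → Chain R (v ∘ f)
Chain-∘ v↑ f↑ i j i<j = v↑ _ _ (f↑ i j i<j)

suc-chain : Chain Fin._<_ (suc {n})
suc-chain _ _ = s<s

inject≤-chain : (m≤n : m ≤ n) → Chain Fin._<_ (λ (i : Fin m) → inject≤ i m≤n)
inject≤-chain m≤n i j i<j rewrite Fin.toℕ-inject≤ i m≤n | Fin.toℕ-inject≤ j m≤n = i<j

Chain-∷ : {R : Rel A ℓ} {x : A} {v : Vector A n} → (∀ i → R x (v i)) → Chain R v → Chain R (x V.∷ v)
Chain-∷ x<v v↑ zero    (suc j) _         = x<v j
Chain-∷ x<v v↑ (suc i) (suc j) (s<s i<j) = v↑ i j i<j

_∷ʳ_ : Vector A n → A → Vector A (suc n)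
_∷ʳ_ {n = zero}  v x = x V.∷ v
_∷ʳ_ {n = suc n} v x = head v V.∷ (tail v ∷ʳ x)

∷ʳ-last : (v : Vector A n) (x : A) → (v ∷ʳ x) (fromℕ n) ≡ x
∷ʳ-last {n = zero}  v x = refl
∷ʳ-last {n = suc n} v x = ∷ʳ-last (tail v) x

∷ʳ-all : {P : A → Set ℓ} {v : Vector A n} {x : A} → (∀ i → P (v i)) → P x → ∀ i → P ((v ∷ʳ x) i)
∷ʳ-all {n = zero}              Pv Px zero    = Px
∷ʳ-all {n = suc n}             Pv Px zero    = Pv zero
∷ʳ-all {n = suc n} {P = P} {v} Pv Px (suc i) = ∷ʳ-all {P = P} {v = tail v} (Pv ∘ suc) Px i

Chain-∷ʳ : {R : Rel A ℓ} {v : Vector A n} {x : A} → Chain R v → (∀ i → R (v i) x) → Chain R (v ∷ʳ x)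
Chain-∷ʳ {n = zero}  {R = R}         v↑ v<x = Chain-∷ {R = R} (λ ()) (λ ())
Chain-∷ʳ {n = suc n} {R = R} {v} {x} v↑ v<x =
  Chain-∷ {R = R} (∷ʳ-all {P = R (head v)} {v = tail v} (λ i → v↑ zero (suc i) (s≤s z≤n)) (v<x zero))
                  (Chain-∷ʳ {R = R} {v = tail v} (Chain-∘ {R = R} v↑ suc-chain) (v<x ∘ suc))

Chain-injective : {p : Fin k → Fin n} → Chain Fin._<_ p → Injective _≡_ _≡_ p
Chain-injective {p = p} p↑ {i} {j} pᵢ≡pⱼ with Fin.<-cmp i j
... | tri< i<j _ _ = contradiction pᵢ≡pⱼ (Fin.<⇒≢ (p↑ i j i<j))
... | tri≈ _ i≡j _ = i≡j
... | tri> _ _ j<i = contradiction (sym pᵢ≡pⱼ) (Fin.<⇒≢ (p↑ j i j<i))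

AllPairs⇒Chain : {R : Rel A ℓ} {xs : List A} → AllPairs R xs → Chain R (lookup xs)
AllPairs⇒Chain (x<xs ∷ _)   zero    (suc j) _         = All.lookup x<xs (∈-lookup j)
AllPairs⇒Chain (_    ∷ xs↑) (suc i) (suc j) (s<s i<j) = AllPairs⇒Chain xs↑ i j i<j

record Runs {A : Set a} (R : Rel A ℓ) (xs : List A) : Set (a ⊔ ℓ) where
  field
    run        : Vector (List A) (length xs)
    run-chain  : ∀ i → AllPairs R (lookup xs i ∷ run i)
    run-⊆      : ∀ i → lookup xs i ∷ run i ⊆ xs
    run-longer : ∀ i j → i Fin.< j → R (lookup xs i) (lookup xs j) → length (run j) < length (run i)

  long-run⇒chain : ∀ {K} i → K ≤ length (run i) → Σ[ p ∈ Vector A (suc K) ] (∀ j → p j ∈ xs) × Chain R p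
  long-run⇒chain i K≤ =
    lookup t ∘ (λ j → inject≤ j (s≤s K≤)) ,
    (λ j → run-⊆ i (∈-lookup {xs = t} (inject≤ j (s≤s K≤)))) ,
    Chain-∘ {R = R} (AllPairs⇒Chain (run-chain i)) (inject≤-chain (s≤s K≤))
    where t = lookup xs i ∷ run i

module _ {R : Rel A ℓ} (R? : Decidable R) (R-trans : Transitive R) where

  runs : ∀ xs → Runs R xs
  runs [] = record { run = λ () ; run-chain = λ () ; run-⊆ = λ () ; run-longer = λ () }
  runs (y ∷ xs) = record
    { run        = best V.∷ run
    ; run-chain  = λ { zero → proj₁ best-good ∷ proj₁ (proj₂ best-good) ; (suc i) → run-chain i }
    ; run-⊆      = λ { zero    → λ { (here refl) → here refl ; (there x∈) → there (proj₂ (proj₂ best-good) x∈) }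
                     ; (suc i) → there ∘ run-⊆ i }
    ; run-longer = λ { zero    (suc j) _         y<xⱼ → best-longest j y<xⱼ
                     ; (suc i) (suc j) (s<s i<j)      → run-longer i j i<j }
    }
    where
    open Runs (runs xs)
    extend : Fin (length xs) → List A
    extend i = lookup xs i ∷ run i
    above : List (Fin (length xs))
    above = filter (λ i → R? y (lookup xs i)) (allFin (length xs))
    best : List A
    best = argmax length [] (map extend above)
    Good : List A → Set _
    Good t = All (R y) t × AllPairs R t × t ⊆ xs
    extend-good : ∀ {i} → R y (lookup xs i) → Good (extend i)
    extend-good {i} y<xᵢ with run-chain i
    ... | xᵢ<run ∷ run↑ = y<xᵢ ∷ All.map (R-trans y<xᵢ) xᵢ<run , xᵢ<run ∷ run↑ , run-⊆ i
    best-good : Good best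
    best-good = argmax-all length {P = Good} ([] , [] , λ ())
                  (All.map⁺ (All.map extend-good (All.all-filter _ (allFin (length xs)))))
    best-longest : ∀ j → R y (lookup xs j) → length (run j) < length best
    best-longest j y<xⱼ = All.lookup (f[xs]≤f[argmax] {f = length} [] (map extend above))
                            (∈-map⁺ extend (∈-filter⁺ (λ i → R? y (lookup xs i)) (∈-allFin j) y<xⱼ))

labels-bounded : ∀ K (f g : Fin m → ℕ) → (∀ i → f i < K × g i < K) →
                 (∀ i j → i Fin.< j → f j < f i ⊎ g j < g i) → m ≤ K * K
labels-bounded K f g bounded decreasing = ℕ.≮⇒≥ λ K*K<m →
  let i , j , i<j , same = Fin.pigeonhole K*K<m label
      fᵢ≡fⱼ , gᵢ≡gⱼ       = Fin.combine-injective {m = K} {n = K} _ _ _ _ same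
  in [ ℕ.<-irrefl (sym (Fin.fromℕ<-injective _ _ _ _ fᵢ≡fⱼ)) ,
       ℕ.<-irrefl (sym (Fin.fromℕ<-injective _ _ _ _ gᵢ≡gⱼ)) ]′ (decreasing i j i<j)
  where
  label : Fin _ → Fin (K * K)
  label i = combine (fromℕ< (proj₁ (bounded i))) (fromℕ< (proj₂ (bounded i)))

module _ {_<₁_ : Rel A ℓ₁} {_<₂_ : Rel A ℓ₂} (_<₁?_ : Decidable _<₁_) (_<₂?_ : Decidable _<₂_)
         (<₁-trans : Transitive _<₁_) (<₂-trans : Transitive _<₂_) where

  private
    module Up   xs = Runs (runs _<₁?_ <₁-trans xs)
    module Down xs = Runs (runs _<₂?_ <₂-trans xs)

  -- Seidenberg's argument: label each element by the lengths of the two runs starting at it.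
  erdős-szekeres : ∀ K {xs} → AllPairs (λ x y → x <₁ y ⊎ x <₂ y) xs → K * K < length xs →
                   Σ[ p ∈ Vector A (suc K) ] (∀ i → p i ∈ xs) × (Chain _<₁_ p ⊎ Chain _<₂_ p)
  erdős-szekeres K {xs} comparable long
    with Fin.any? (λ i → (K ≤? length (Up.run xs i)) ⊎-dec (K ≤? length (Down.run xs i)))
  ... | yes (i , inj₁ K≤) = map₂ (map₂ inj₁) (Up.long-run⇒chain xs i K≤)
  ... | yes (i , inj₂ K≤) = map₂ (map₂ inj₂) (Down.long-run⇒chain xs i K≤)
  ... | no short = contradiction long (ℕ.≤⇒≯ (labels-bounded K (length ∘ Up.run xs) (length ∘ Down.run xs)
        (λ i → ℕ.≰⇒> (short ∘ (i ,_) ∘ inj₁) , ℕ.≰⇒> (short ∘ (i ,_) ∘ inj₂))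
        (λ i j i<j → Sum.map (Up.run-longer xs i j i<j) (Down.run-longer xs i j i<j)
                             (AllPairs⇒Chain comparable i j i<j))))

Ascends : Word n → Rel (Fin n) _
Ascends w a b = a Fin.< b × w a Fin.< w b

Descends : Word n → Rel (Fin n) _
Descends w a b = a Fin.< b × w b Fin.< w a

Monotone : Word n → (Fin k → Fin n) → Set
Monotone w p = Chain (Ascends w) p ⊎ Chain (Descends w) p

monotone⇒sorted : {w : Word n} {p : Fin k → Fin n} → Monotone w p → Chain Fin._<_ p
monotone⇒sorted (inj₁ p↑) i j i<j = proj₁ (p↑ i j i<j)
monotone⇒sorted (inj₂ p↓) i j i<j = proj₁ (p↓ i j i<j)

reflect : (Fin k → Fin n) → Fin n → Fin n
reflect p j with Fin.any? (λ i → p i Fin.≟ j)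
... | yes (i , _) = p (opposite i)
... | no _        = j

module _ {p : Fin k → Fin n} (p-injective : Injective _≡_ _≡_ p) where

  reflect-on : ∀ i → reflect p (p i) ≡ p (opposite i)
  reflect-on i with Fin.any? (λ i′ → p i′ Fin.≟ p i)
  ... | yes (i′ , pᵢ′≡pᵢ) = cong (p ∘ opposite) (p-injective pᵢ′≡pᵢ)
  ... | no missing        = contradiction (i , refl) missing

  reflect-on-opposite : ∀ i → reflect p (p (opposite i)) ≡ p i
  reflect-on-opposite i = trans (reflect-on (opposite i)) (cong p (Fin.opposite-involutive i))

  reflect-off : ∀ {j} → (∀ i → p i ≢ j) → reflect p j ≡ j
  reflect-off {j} off with Fin.any? (λ i → p i Fin.≟ j)
  ... | yes (i , pᵢ≡j) = contradiction pᵢ≡j (off i)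
  ... | no _           = refl

  reflect-involutive : ∀ j → reflect p (reflect p j) ≡ j
  reflect-involutive j with Fin.any? (λ i → p i Fin.≟ j)
  ... | yes (i , refl) = reflect-on-opposite i
  ... | no missing     = reflect-off (λ i pᵢ≡j → missing (i , pᵢ≡j))

module _ {w : Word n} {p : Fin k → Fin n} where

  reflect-injective : Injective _≡_ _≡_ w → Chain Fin._<_ p → Injective _≡_ _≡_ (w ∘ reflect p)
  reflect-injective w-injective p↑ {i} {j} wσᵢ≡wσⱼ = begin
    i                       ≡⟨ reflect-involutive p-injective i ⟨
    reflect p (reflect p i) ≡⟨ cong (reflect p) (w-injective wσᵢ≡wσⱼ) ⟩
    reflect p (reflect p j) ≡⟨ reflect-involutive p-injective j ⟩
    j                       ∎
    where
    open ≡-Reasoning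
    p-injective = Chain-injective p↑

  reflect-replace : Monotone w p → Replace k w (w ∘ reflect p)
  reflect-replace monotone =
    p , p↑ , letters monotone ,
    (λ i → cong w (reflect-on p-injective i)) , (λ j off → cong w (reflect-off p-injective off))
    where
    p↑ = monotone⇒sorted {w = w} monotone
    p-injective = Chain-injective p↑
    letters : Monotone w p → IncreasingAt w p ⊎ DecreasingAt w p
    letters (inj₁ ascends)  = inj₁ λ i j i<j → proj₂ (ascends i j i<j)
    letters (inj₂ descends) = inj₂ λ i j i<j → proj₂ (descends i j i<j)

  reflect-descending : Chain (Descends w) p → Chain (Ascends (w ∘ reflect p)) p
  reflect-descending p↓ i j i<j =
    proj₁ (p↓ i j i<j) ,
    subst₂ Fin._<_ (at i) (at j) (proj₂ (p↓ (opposite j) (opposite i) (opposite-< i<j)))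
    where at = λ i → sym (cong w (reflect-on (Chain-injective (monotone⇒sorted {w = w} (inj₂ p↓))) i))

  reflect-ascending : Chain (Ascends w) p → Chain (Descends (w ∘ reflect p)) p
  reflect-ascending p↑ i j i<j =
    proj₁ (p↑ i j i<j) ,
    subst₂ Fin._<_ (at j) (at i) (proj₂ (p↑ (opposite j) (opposite i) (opposite-< i<j)))
    where at = λ i → sym (cong w (reflect-on (Chain-injective (monotone⇒sorted {w = w} (inj₁ p↑))) i))

FixesPrefix : ℕ → Word n → Set
FixesPrefix s w = Injective _≡_ _≡_ w × (∀ i → toℕ i < s → w i ≡ i)

module _ {s} {w : Word n} (fixes : FixesPrefix s w) where

  fixesPrefix-agree : ∀ {w′} → Injective _≡_ _≡_ w′ → (∀ {i} → toℕ i < s → w′ i ≡ w i) → FixesPrefix s w′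
  fixesPrefix-agree w′-injective agree = w′-injective , λ i i<s → trans (agree i<s) (proj₂ fixes i i<s)

  fixesPrefix-suc : ∀ {x} → toℕ x ≡ s → w x ≡ x → FixesPrefix (suc s) w
  fixesPrefix-suc {x} x≡s wx≡x = proj₁ fixes , λ i i≤s →
    [ proj₂ fixes i , (λ i≡s → subst (λ i → w i ≡ i) (Fin.toℕ-injective (trans x≡s (sym i≡s))) wx≡x) ]′
      (ℕ.m≤n⇒m<n∨m≡n (ℕ.≤-pred i≤s))

  fixesPrefix-≥ : ∀ {j} → s ≤ toℕ j → s ≤ toℕ (w j)
  fixesPrefix-≥ {j} s≤j = ℕ.≮⇒≥ λ wj<s →
    ℕ.<⇒≱ (subst (λ i → toℕ i < s) (proj₁ fixes (proj₂ fixes (w j) wj<s)) wj<s) s≤j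

  reflect-fixesPrefix : {q : Fin k → Fin n} → Chain Fin._<_ q → (∀ i → s ≤ toℕ (q i)) → FixesPrefix s (w ∘ reflect q)
  reflect-fixesPrefix q↑ s≤q = fixesPrefix-agree (reflect-injective (proj₁ fixes) q↑) λ i<s →
    cong w (reflect-off (Chain-injective q↑) (λ j qⱼ≡i → ℕ.<⇒≱ i<s (subst (λ i → s ≤ toℕ i) qⱼ≡i (s≤q j))))

  module _ {x m : Fin n} (x≡s : toℕ x ≡ s) (wm≡x : w m ≡ x) where

    fixesPrefix-position : s ≤ toℕ m
    fixesPrefix-position = ℕ.≮⇒≥ λ m<s →
      ℕ.<-irrefl (trans (cong toℕ (trans (sym (proj₂ fixes m m<s)) wm≡x)) x≡s) m<s

    fixesPrefix-minimum : ∀ {j} → s ≤ toℕ j → j ≢ m → x Fin.< w j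
    fixesPrefix-minimum s≤j j≢m =
      Fin.≤∧≢⇒< (subst (_≤ toℕ _) (sym x≡s) (fixesPrefix-≥ s≤j))
                (λ x≡wj → j≢m (proj₁ fixes (trans (sym x≡wj) (sym wm≡x))))

record MonotoneRun (k : ℕ) (R : Word n → Rel (Fin n) _) (w : Word n) (xs : List (Fin n)) : Set where
  field
    word      : Word n
    injective : Injective _≡_ _≡_ word
    reachable : Equiv k w word
    positions : Fin k → Fin n
    chain     : Chain (R word) positions
    within    : ∀ i → positions i ∈ xs
    unchanged : ∀ {j} → j ∉ xs → word j ≡ w j
    letter    : ∀ i → ∃[ j ] j ∈ xs × word (positions i) ≡ w j

  letter-satisfies : (P : Fin n → Set) → All (P ∘ w) xs → ∀ i → P (word (positions i))
  letter-satisfies P P∘w i with letter i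
  ... | j , j∈xs , eq = subst P (sym eq) (All.lookup P∘w j∈xs)

  run-fixesPrefix : ∀ {s} → FixesPrefix s w → All (λ j → s ≤ toℕ j) xs → FixesPrefix s word
  run-fixesPrefix fixes s≤xs = fixesPrefix-agree fixes injective (λ i<s → unchanged (All⇒∉ s≤xs (ℕ.<⇒≱ i<s)))

module _ {w : Word n} (w-injective : Injective _≡_ _≡_ w) where

  sorted⇒comparable : ∀ {xs} → AllPairs Fin._<_ xs → AllPairs (λ a b → Ascends w a b ⊎ Descends w a b) xs
  sorted⇒comparable = AllPairs.map compare
    where
    compare : ∀ {a b} → a Fin.< b → Ascends w a b ⊎ Descends w a b
    compare {a} {b} a<b with Fin.<-cmp (w a) (w b)
    ... | tri< wa<wb _ _ = inj₁ (a<b , wa<wb)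
    ... | tri≈ _ wa≡wb _ = contradiction (w-injective wa≡wb) (Fin.<⇒≢ a<b)
    ... | tri> _ _ wb<wa = inj₂ (a<b , wb<wa)

  monotone-subsequence : ∀ K {xs} → AllPairs Fin._<_ xs → K * K < length xs →
                         Σ[ p ∈ (Fin (suc K) → Fin n) ] (∀ i → p i ∈ xs) × Monotone w p
  monotone-subsequence K sorted =
    erdős-szekeres (λ a b → (a <? b) ×-dec (w a <? w b)) (λ a b → (a <? b) ×-dec (w b <? w a))
      (λ (a<b , wa<wb) (b<c , wb<wc) → Fin.<-trans a<b b<c , Fin.<-trans wa<wb wb<wc)
      (λ (a<b , wb<wa) (b<c , wc<wb) → Fin.<-trans a<b b<c , Fin.<-trans wc<wb wb<wa)
      K (sorted⇒comparable sorted)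

  private
    unmoved : ∀ {k xs} {R : Word n → Rel (Fin n) _} (p : Fin k → Fin n) →
              (∀ i → p i ∈ xs) → Chain (R w) p → MonotoneRun k R w xs
    unmoved p p∈xs p-chain = record
      { word = w ; injective = w-injective ; reachable = ε ; positions = p ; chain = p-chain
      ; within = p∈xs ; unchanged = λ _ → refl ; letter = λ i → p i , p∈xs i , refl }

    reflected : ∀ {k xs} {R : Word n → Rel (Fin n) _} (p : Fin k → Fin n) →
                (∀ i → p i ∈ xs) → (monotone : Monotone w p) → Chain (R (w ∘ reflect p)) p → MonotoneRun k R w xs
    reflected {xs = xs} p p∈xs monotone p-chain = record
      { word = w ∘ reflect p ; injective = reflect-injective w-injective p↑
      ; reachable = reflect-replace monotone ◅ ε ; positions = p ; chain = p-chain ; within = p∈xs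
      ; unchanged = λ j∉xs → cong w (reflect-off p-injective (λ i pᵢ≡j → j∉xs (subst (_∈ xs) pᵢ≡j (p∈xs i))))
      ; letter = λ i → p (opposite i) , p∈xs (opposite i) , cong w (reflect-on p-injective i) }
      where
      p↑ = monotone⇒sorted {w = w} monotone
      p-injective = Chain-injective p↑

  ascending-run : ∀ K {xs} → AllPairs Fin._<_ xs → K * K < length xs → MonotoneRun (suc K) Ascends w xs
  ascending-run K sorted long with monotone-subsequence K sorted long
  ... | p , p∈xs , inj₁ p↑ = unmoved p p∈xs p↑
  ... | p , p∈xs , inj₂ p↓ = reflected p p∈xs (inj₂ p↓) (reflect-descending {w = w} p↓)

  descending-run : ∀ K {xs} → AllPairs Fin._<_ xs → K * K < length xs → MonotoneRun (suc K) Descends w xs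
  descending-run K sorted long with monotone-subsequence K sorted long
  ... | p , p∈xs , inj₁ p↑ = reflected p p∈xs (inj₁ p↑) (reflect-ascending {w = w} p↑)
  ... | p , p∈xs , inj₂ p↓ = unmoved p p∈xs p↓

module Normalise (K′ : ℕ) where

  K N : ℕ
  K = suc K′
  N = K * K

  module _ {s} {x : Fin n} (x≡s : toℕ x ≡ s) where

    private
      after : ∀ {j : Fin n} → x Fin.< j → s ≤ toℕ j
      after {j} x<j = ℕ.<⇒≤ (subst (_< toℕ j) x≡s x<j)

    move-minimum-into : ∀ {w m xs} → FixesPrefix s w → w m ≡ x → AllPairs Fin._<_ xs → All (m Fin.<_) xs →
                        N < length xs → ∃[ w′ ] ∃[ m′ ] FixesPrefix s w′ × w′ m′ ≡ x × m′ ∈ xs × Equiv (suc K) w w′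
    move-minimum-into {w} {m} {xs} fixes wm≡x sorted m<xs long =
      word ∘ reflect q , q (opposite zero) ,
      reflect-fixesPrefix fixes₁ q-sorted s≤q ,
      trans (cong word (reflect-on-opposite (Chain-injective q-sorted) zero)) word-m ,
      within _ ,
      reachable ◅◅ (reflect-replace (inj₁ q↑) ◅ ε)
      where
      open MonotoneRun (ascending-run (proj₁ fixes) K sorted long)
      s≤m = fixesPrefix-position fixes x≡s wm≡x
      s≤xs : All (λ j → s ≤ toℕ j) xs
      s≤xs = All.map (λ m<j → ℕ.<⇒≤ (ℕ.≤-<-trans s≤m m<j)) m<xs
      fixes₁ = run-fixesPrefix fixes s≤xs
      word-m : word m ≡ x
      word-m = trans (unchanged (All⇒∉ m<xs (Fin.<-irrefl refl))) wm≡x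
      q : Fin (suc K) → Fin n
      q = m V.∷ (positions ∘ suc)
      s≤q : ∀ i → s ≤ toℕ (q i)
      s≤q zero    = s≤m
      s≤q (suc i) = All.lookup s≤xs (within (suc i))
      q↑ : Chain (Ascends word) q
      q↑ = Chain-∷ {R = Ascends word}
             (λ i → let m<qᵢ = All.lookup m<xs (within (suc i)) in
                    m<qᵢ , subst (Fin._< word (positions (suc i))) (sym word-m)
                             (fixesPrefix-minimum fixes₁ x≡s word-m (s≤q (suc i)) (λ e → Fin.<-irrefl (sym e) m<qᵢ)))
             (Chain-∘ {R = Ascends word} chain suc-chain)
      q-sorted = monotone⇒sorted {w = word} (inj₁ q↑)

    raise-letter : ∀ {w xs} → FixesPrefix s w → AllPairs Fin._<_ xs → All (x Fin.<_) xs →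
                   All (λ j → w x Fin.< w j) xs → N < length xs →
                   ∃[ w′ ] FixesPrefix s w′ × (∀ {j} → j ≢ x → j ∉ xs → w′ j ≡ w j) × w x Fin.< w′ x
                           × Equiv (suc K) w w′
    raise-letter {w} {xs} fixes sorted x<xs above long =
      word ∘ reflect q ,
      reflect-fixesPrefix fixes₁ q-sorted s≤q ,
      elsewhere ,
      subst (w x Fin.<_) (sym (cong word (reflect-on q-injective zero)))
        (letter-satisfies (w x Fin.<_) above (suc (fromℕ K′))) ,
      reachable ◅◅ (reflect-replace (inj₁ q↑) ◅ ε)
      where
      open MonotoneRun (ascending-run (proj₁ fixes) K sorted long)
      fixes₁ = run-fixesPrefix fixes (All.map after x<xs)
      word-x : word x ≡ w x
      word-x = unchanged (All⇒∉ x<xs (Fin.<-irrefl refl))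
      q : Fin (suc K) → Fin n
      q = x V.∷ (positions ∘ suc)
      s≤q : ∀ i → s ≤ toℕ (q i)
      s≤q zero    = ℕ.≤-reflexive (sym x≡s)
      s≤q (suc i) = after (All.lookup x<xs (within (suc i)))
      q↑ : Chain (Ascends word) q
      q↑ = Chain-∷ {R = Ascends word}
             (λ i → All.lookup x<xs (within (suc i)) ,
                    subst (Fin._< word (positions (suc i))) (sym word-x) (letter-satisfies (w x Fin.<_) above (suc i)))
             (Chain-∘ {R = Ascends word} chain suc-chain)
      q-sorted = monotone⇒sorted {w = word} (inj₁ q↑)
      q-injective = Chain-injective q-sorted
      elsewhere : ∀ {j} → j ≢ x → j ∉ xs → word (reflect q j) ≡ w j
      elsewhere {j} j≢x j∉xs = trans (cong word (reflect-off q-injective off)) (unchanged j∉xs)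
        where
        off : ∀ i → q i ≢ j
        off zero    = j≢x ∘ sym
        off (suc i) = λ qᵢ≡j → j∉xs (subst (_∈ xs) qᵢ≡j (within (suc i)))

    settle-minimum : ∀ {w m xs} → FixesPrefix s w → w m ≡ x → x Fin.< m → AllPairs Fin._<_ xs →
                     All (λ j → x Fin.< j × j Fin.< m) xs → All (λ j → w j Fin.< w x) xs → N < length xs →
                     ∃[ w′ ] FixesPrefix (suc s) w′ × Equiv (suc K) w w′
    settle-minimum {w} {m} {xs} fixes wm≡x x<m sorted between below long =
      word ∘ reflect q ,
      fixesPrefix-suc (reflect-fixesPrefix fixes₁ q-sorted s≤q) x≡s settled ,
      reachable ◅◅ (reflect-replace (inj₂ q↓) ◅ ε)
      where
      open MonotoneRun (descending-run (proj₁ fixes) K sorted long)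
      fixes₁ = run-fixesPrefix fixes (All.map (after ∘ proj₁) between)
      word-x : word x ≡ w x
      word-x = unchanged (All⇒∉ between (Fin.<-irrefl refl ∘ proj₁))
      word-m : word m ≡ x
      word-m = trans (unchanged (All⇒∉ between (Fin.<-irrefl refl ∘ proj₂))) wm≡x
      middle : Fin K′ → Fin n
      middle i = positions (suc (suc i))
      middle-between : ∀ i → x Fin.< middle i × middle i Fin.< m
      middle-between i = All.lookup between (within (suc (suc i)))
      q : Fin (suc K) → Fin n
      q = x V.∷ (middle ∷ʳ m)
      s≤q : ∀ i → s ≤ toℕ (q i)
      s≤q zero    = ℕ.≤-reflexive (sym x≡s)
      s≤q (suc i) = ∷ʳ-all {P = λ j → s ≤ toℕ j} {v = middle} (after ∘ proj₁ ∘ middle-between) (after x<m) i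
      below-x : ∀ i → Descends word x ((middle ∷ʳ m) i)
      below-x = ∷ʳ-all {P = Descends word x} {v = middle}
        (λ i → proj₁ (middle-between i) ,
               subst (word (middle i) Fin.<_) (sym word-x) (letter-satisfies (Fin._< w x) below (suc (suc i))))
        (x<m , subst (Fin._< word x) (sym word-m)
                 (fixesPrefix-minimum fixes₁ x≡s word-m (s≤q zero) (λ x≡m → Fin.<-irrefl x≡m x<m)))
      above-m : ∀ i → Descends word (middle i) m
      above-m i = proj₂ (middle-between i) ,
                  subst (Fin._< word (middle i)) (sym word-m)
                    (fixesPrefix-minimum fixes₁ x≡s word-m (after (proj₁ (middle-between i)))
                      (λ e → Fin.<-irrefl e (proj₂ (middle-between i))))
      q↓ : Chain (Descends word) q
      q↓ = Chain-∷ {R = Descends word} below-x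
             (Chain-∷ʳ {R = Descends word} {v = middle} (Chain-∘ {R = Descends word} chain (λ _ _ → s<s ∘ s<s)) above-m)
      q-sorted = monotone⇒sorted {w = word} (inj₂ q↓)
      settled : word (reflect q x) ≡ x
      settled = begin
        word (reflect q x)              ≡⟨ cong word (reflect-on (Chain-injective q-sorted) zero) ⟩
        word ((middle ∷ʳ m) (fromℕ K′)) ≡⟨ cong word (∷ʳ-last middle m) ⟩
        word m                          ≡⟨ word-m ⟩
        x                               ∎
        where open ≡-Reasoning

    move-minimum-beyond : ∀ {w m xs} r → FixesPrefix s w → w m ≡ x → AllPairs Fin._<_ xs →
                          All (λ j → r ≤ toℕ j) xs → N < length xs →
                          ∃[ w′ ] ∃[ m′ ] FixesPrefix s w′ × w′ m′ ≡ x × r ≤ toℕ m′ × Equiv (suc K) w w′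
    move-minimum-beyond {w} {m} r fixes wm≡x sorted r≤xs long with r ≤? toℕ m
    ... | yes r≤m = w , m , fixes , wm≡x , r≤m , ε
    ... | no r≰m  =
      let w′ , m′ , fixes′ , w′m′≡x , m′∈xs , steps =
            move-minimum-into fixes wm≡x sorted (All.map (ℕ.<-≤-trans (ℕ.≰⇒> r≰m)) r≤xs) long
      in w′ , m′ , fixes′ , w′m′≡x , All.lookup r≤xs m′∈xs , steps

    place-minimum : ∀ {w m xs} → FixesPrefix s w → w m ≡ x → x Fin.< m → AllPairs Fin._<_ xs →
                    All (λ j → x Fin.< j × j Fin.< m) xs → N + suc N ≤ length xs →
                    ∃[ w′ ] FixesPrefix (suc s) w′ × Equiv (suc K) w w′
    place-minimum {w} {m} {xs} fixes wm≡x x<m sorted between long = go (>-wellFounded (w x)) fixes wm≡x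
      where
      above? : (w : Word n) → U.Decidable (λ j → w x Fin.< w j)
      above? w j = w x <? w j
      go : ∀ {w} → Acc Fin._>_ (w x) → FixesPrefix s w → w m ≡ x → ∃[ w′ ] FixesPrefix (suc s) w′ × Equiv (suc K) w w′
      go {w} (acc larger) fixes wm≡x with N ℕ.<? length (filter (above? w) xs)
      ... | yes many =
        let w₁ , fixes₁ , elsewhere , rises , steps₁ =
              raise-letter fixes (AllPairs.filter⁺ (above? w) sorted) (All.filter⁺ (above? w) (All.map proj₁ between))
                           (All.all-filter (above? w) xs) many
            m-unchanged = elsewhere (λ m≡x → Fin.<-irrefl (sym m≡x) x<m)
                                    (All⇒∉ (All.filter⁺ (above? w) (All.map proj₂ between)) (Fin.<-irrefl refl))
            w₂ , fixes₂ , steps₂ = go (larger rises) fixes₁ (trans m-unchanged wm≡x)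
        in w₂ , fixes₂ , steps₁ ◅◅ steps₂
      ... | no few = settle-minimum fixes wm≡x x<m (AllPairs.filter⁺ below? sorted) (All.filter⁺ below? between)
                       below enough
        where
        below? = ∁? (above? w)
        below : All (λ j → w j Fin.< w x) (filter below? xs)
        below = All.map (λ (¬above , x<j , _) → Fin.≤∧≢⇒< (ℕ.≮⇒≥ ¬above)
                                                  (λ wj≡wx → Fin.<-irrefl (sym (proj₁ fixes wj≡wx)) x<j))
                        (All.zip (All.all-filter below? xs , All.filter⁺ below? between))
        enough : N < length (filter below? xs)
        enough = ℕ.+-cancelˡ-≤ N _ _ (begin
          N + suc N                                                  ≤⟨ long ⟩
          length xs                                                  ≡⟨ length-filter-∁ (above? w) xs ⟨
          length (filter (above? w) xs) + length (filter below? xs) ≤⟨ ℕ.+-monoˡ-≤ _ (ℕ.≮⇒≥ few) ⟩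
          N + length (filter below? xs)                              ∎)
          where open ℕ.≤-Reasoning

  D : ℕ
  D = N + suc N + suc N

  extend-prefix : ∀ {s} {w : Word n} → suc s + D ≤ n → FixesPrefix s w →
                  ∃[ w′ ] FixesPrefix (suc s) w′ × Equiv (suc K) w w′
  extend-prefix {n} {s} {w} room fixes =
    let m , wm≡x = injective⇒surjective (proj₁ fixes) x
        w₁ , m₁ , fixes₁ , w₁m₁≡x , r≤m₁ , steps₁ =
          move-minimum-beyond x≡s r fixes wm≡x (segment-sorted r (suc N) R-fits)
            (All.map proj₁ (segment-bounds r (suc N) R-fits)) (ℕ.≤-reflexive (sym (segment-length r (suc N) R-fits)))
        w₂ , fixes₂ , steps₂ =
          place-minimum x≡s fixes₁ w₁m₁≡x (ℕ.<-≤-trans x<r r≤m₁) (segment-sorted (suc s) (N + suc N) B-fits)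
            (All.map (between r≤m₁) (segment-bounds (suc s) (N + suc N) B-fits))
            (ℕ.≤-reflexive (sym (segment-length (suc s) (N + suc N) B-fits)))
    in w₂ , fixes₂ , steps₁ ◅◅ steps₂
    where
    r : ℕ
    r = suc s + (N + suc N)
    R-fits : r + suc N ≤ n
    R-fits = subst (_≤ n) (sym (ℕ.+-assoc (suc s) (N + suc N) (suc N))) room
    B-fits : suc s + (N + suc N) ≤ n
    B-fits = ℕ.≤-trans (ℕ.m≤m+n r (suc N)) R-fits
    s<n : s < n
    s<n = ℕ.≤-trans (ℕ.m≤m+n (suc s) D) room
    x : Fin n
    x = fromℕ< s<n
    x≡s : toℕ x ≡ s
    x≡s = Fin.toℕ-fromℕ< s<n
    x<r : toℕ x < r
    x<r = subst (_< r) (sym x≡s) (ℕ.m≤m+n (suc s) _)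
    between : ∀ {m j} → r ≤ toℕ m → suc s ≤ toℕ j × toℕ j < r → x Fin.< j × j Fin.< m
    between r≤m (s<j , j<r) = subst (_< _) (sym x≡s) s<j , ℕ.<-≤-trans j<r r≤m

  fix-prefix : ∀ t {w : Word n} → t + D ≤ n → Injective _≡_ _≡_ w → ∃[ b ] FixesPrefix t b × Equiv (suc K) w b
  fix-prefix zero    {w} _    w-injective = w , (w-injective , λ _ ()) , ε
  fix-prefix (suc t)     room w-injective =
    let b  , fixes  , steps  = fix-prefix t (ℕ.≤-trans (ℕ.n≤1+n _) room) w-injective
        b′ , fixes′ , steps′ = extend-prefix room fixes
    in b′ , fixes′ , steps ◅◅ steps′

  normal-form : (w : Word n) → Injective _≡_ _≡_ w →
                ∃[ b ] Injective _≡_ _≡_ b × Equiv (suc K) w b × (∀ i → toℕ i < n ∸ D → b i ≡ i)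
  normal-form {n} w w-injective with D ≤? n
  ... | yes D≤n = let b , (b-injective , fixed) , steps =
                        fix-prefix (n ∸ D) (ℕ.≤-reflexive (ℕ.m∸n+n≡m D≤n)) w-injective
                  in b , b-injective , steps , fixed
  ... | no D≰n  = w , w-injective , ε , λ i i<n∸D →
                  contradiction (subst (toℕ i <_) (ℕ.m≤n⇒m∸n≡0 (ℕ.<⇒≤ (ℕ.≰⇒> D≰n))) i<n∸D) λ ()

D-closed-form : ∀ K′ → 3 * suc (suc K′) * suc (suc K′) + 5 ∸ 6 * suc (suc K′) ≡ Normalise.D K′
D-closed-form K′ = trans (cong (_∸ 6 * suc (suc K′)) (expand K′)) (ℕ.m+n∸n≡m (Normalise.D K′) (6 * suc (suc K′)))
  where
  expand : ∀ K′ → let N = suc K′ * suc K′ in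
           3 * suc (suc K′) * suc (suc K′) + 5 ≡ N + suc N + suc N + 6 * suc (suc K′)
  expand = solve-∀

corollary2p4 : (k n : ℕ) → 2 ≤ k → 1 ≤ n → (w : Word n) → Injective _≡_ _≡_ w →
    Σ (Word n) λ b → Injective _≡_ _≡_ b × Equiv k w b
      × (∀ (i : Fin n) → suc (toℕ i) ≤ n ∸ (3 * k * k + 5 ∸ 6 * k) → b i ≡ i)
corollary2p4 (suc (suc K′)) n (s≤s (s≤s _)) _ w w-injective
  rewrite D-closed-form K′ = Normalise.normal-form K′ w w-injective
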